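{- Let $R$ be a commutative unital ring ($0\neq 1$) satisfying Axioms 1, 2, 3 and $4^+$ (described in the context) with respect to a fixed $\mathcal{L}_{rings}$-formula $\varphi(x)$ in one free variable. Suppose $Y_1,\dots,Y_k$ is a partition of $\mathbb{B}$ (i.e. $Y_1\vee\dots\vee Y_k=1$ and $Y_i\wedge Y_j=0$ for $i\neq j$). Suppose $\langle\Theta_1(x_1,\dots,x_m,x_{m+1}),\dots,\Theta_k(x_1,\dots,x_m,x_{m+1})\rangle$ is a partition of $\mathcal{L}_{rings}$-formulas. Let $f_1,\dots,f_m\in R$ be such that for each $j$, $$Y_j\leq [[\exists x_{m+1}\, \Theta_j(f_1,\dots,f_m,x_{m+1})]],$$ and such that for each $j$ the element $$Y_j\wedge \neg [[\exists x_{m+1}\,( \varphi(x_{m+1}) \wedge \Theta_j(f_1,\dots,f_m,x_{m+1}))]]$$ is finite (a finite join of atoms of $\mathbb{B}$). Then there is $g\in R$ such that $Y_j\leq [[\Theta_j(f_1,\dots,f_m,g)]]$ for all $j$.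
   Context: All rings are commutative and unital with $0\neq 1$; $\mathcal{L}_{rings}=\{+,\cdot,0,1\}$. For a ring $R$, $\mathbb{B}$ is the Boolean algebra of idempotents $\{x: x=x^2\}$ with $e\wedge f=ef$, $\neg e=1-e$, $e\vee f=e+f-ef$, $0$, $1$, and order $e\leq f\iff ef=e$. An atom is a minimal nonzero element of $\mathbb{B}$. For an idempotent $e$, $R_e$ denotes the localization of $R$ at $\{e^n:n\geq 0\}$ (isomorphic to $R/(1-e)R$), and for $f\in R$, $(f)_e$ is its image in $R_e$. For an $\mathcal{L}_{rings}$-formula $\Theta(x_1,\dots,x_n)$ and $f_1,\dots,f_n\in R$, $[[\Theta(f_1,\dots,f_n)]]$ denotes the supremum in $\mathbb{B}$ of the set of atoms $e$ with $R_e\models\Theta((f_1)_e,\dots,(f_n)_e)$, when this supremum exists. An element of $\mathbb{B}$ is finite if it is a finite join of atoms; for $a\leq b$, $a$ is cofinite in $b$ if $b\wedge\neg a$ is finite. A sequence $\langle\Theta_1,\dots,\Theta_k\rangle$ of formulas in the same variables is a partition if $\Theta_1\vee\dots\vee\Theta_k$ and $\neg(\Theta_i\wedge\Theta_j)$ ($i\neq j$) are logically valid. Axiom 1: $\mathbb{B}$ is atomic. Axiom 2: $[[\Theta(f_1,\dots,f_n)]]$ exists in $\mathbb{B}$ for every $\mathcal{L}_{rings}$-formula $\Theta$ and all $f_i\in R$. Axiom 3: for every atomic $\mathcal{L}_{rings}$-formula $\Theta$, $R\models\Theta(f_1,\dots,f_n)$ iff $[[\Theta(f_1,\dots,f_n)]]=1$.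 Axiom $4^+$: for every $\mathcal{L}_{rings}$-formula $\Theta(x_1,\dots,x_n,w)$ and all $f_1,\dots,f_n\in R$ there is $g\in R$ such that if $[[\exists w\,\Theta(f_1,\dots,f_n,w)]]\wedge\neg[[\exists w\,(\varphi(w)\wedge\Theta(f_1,\dots,f_n,w))]]$ is finite, then $[[\exists w\,\Theta(f_1,\dots,f_n,w)]]\wedge\neg[[\Theta(f_1,\dots,f_n,g)]]$ is finite. -}

module Defs where

open import Level using (Level; _⊔_; Lift) renaming (suc to lsuc)
open import Data.Nat using (ℕ) renaming (suc to nsuc)
open import Data.Fin as Fin using (Fin; zero; suc)
open import Data.Product using (Σ; _×_; _,_; proj₁; proj₂)
open import Data.Sum using (_⊎_)
open import Data.List using (List; []; _∷_)
open import Data.List.Relation.Unary.All using (All)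
open import Data.Vec.Functional using (Vector) renaming (_∷_ to _∷ᵥ_)
open import Relation.Nullary using (¬_)
open import Relation.Binary using (Rel; IsEquivalence)
open import Relation.Binary.PropositionalEquality using (_≢_)
open import Algebra.Bundles using (CommutativeRing)
import Relation.Binary.Reasoning.Setoid as SetoidReasoning

-- Quantifiers bind the
-- variable `zero`; the free variable `suc i` of the body is the
-- variable `i` of the enclosing formula.

data Term (n : ℕ) : Set where
  var  : Fin n → Term n
  `0   : Term n
  `1   : Term n
  _`+_ : Term n → Term n → Term n
  _`*_ : Term n → Term n → Term n

data Formula (n : ℕ) : Set where
  _`≈_ : Term n → Term n → Formula n
  `¬_  : Formula n → Formula n
  _`∧_ : Formula n → Formula n → Formula n
  _`∨_ : Formula n → Formula n → Formula n
  `∃   : Formula (nsuc n) → Formula n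
  `∀   : Formula (nsuc n) → Formula n

liftRen : ∀ {n k} → (Fin n → Fin k) → Fin (nsuc n) → Fin (nsuc k)
liftRen r zero    = zero
liftRen r (suc i) = suc (r i)

renT : ∀ {n k} → (Fin n → Fin k) → Term n → Term k
renT r (var i)  = var (r i)
renT r `0       = `0
renT r `1       = `1
renT r (s `+ t) = renT r s `+ renT r t
renT r (s `* t) = renT r s `* renT r t

renF : ∀ {n k} → (Fin n → Fin k) → Formula n → Formula k
renF r (s `≈ t) = renT r s `≈ renT r t
renF r (`¬ φ)   = `¬ renF r φ
renF r (φ `∧ ψ) = renF r φ `∧ renF r ψ
renF r (φ `∨ ψ) = renF r φ `∨ renF r ψ
renF r (`∃ φ)   = `∃ (renF (liftRen r) φ)
renF r (`∀ φ)   = `∀ (renF (liftRen r) φ)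

-- Given φ(x) in one free variable, φ(w) as a formula in the variables
-- (w, x_1, ..., x_n) where w = var zero (the variable bound by ∃ w).
atW : ∀ {n} → Formula 1 → Formula (nsuc n)
atW φ = renF (λ _ → zero) φ

-- L_rings-structures (equality interpreted by a congruence, which is
-- the same as interpreting it by true equality on the quotient).

record Structure (a ℓ : Level) : Set (lsuc (a ⊔ ℓ)) where
  field
    Carrier       : Set a
    _≈_           : Rel Carrier ℓ
    isEquivalence : IsEquivalence _≈_
    _+_           : Carrier → Carrier → Carrier
    _*_           : Carrier → Carrier → Carrier
    0#            : Carrier
    1#            : Carrier
    +-cong        : ∀ {x y u v} → x ≈ y → u ≈ v → (x + u) ≈ (y + v)
    *-cong        : ∀ {x y u v} → x ≈ y → u ≈ v → (x * u) ≈ (y * v)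

module _ {a ℓ : Level} (M : Structure a ℓ) where
  open Structure M

  evalT : ∀ {n} → Vector Carrier n → Term n → Carrier
  evalT ρ (var i)  = ρ i
  evalT ρ `0       = 0#
  evalT ρ `1       = 1#
  evalT ρ (s `+ t) = evalT ρ s + evalT ρ t
  evalT ρ (s `* t) = evalT ρ s * evalT ρ t

  Sat : ∀ {n} → Formula n → Vector Carrier n → Set (a ⊔ ℓ)
  Sat (s `≈ t) ρ = Lift a (evalT ρ s ≈ evalT ρ t)
  Sat (`¬ φ)   ρ = ¬ Sat φ ρ
  Sat (φ `∧ ψ) ρ = Sat φ ρ × Sat ψ ρ
  Sat (φ `∨ ψ) ρ = Sat φ ρ ⊎ Sat ψ ρ
  Sat (`∃ φ)   ρ = Σ Carrier (λ x → Sat φ (x ∷ᵥ ρ))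
  Sat (`∀ φ)   ρ = ∀ x → Sat φ (x ∷ᵥ ρ)

IsFormulaPartition : (a ℓ : Level) → ∀ {k n} → (Fin k → Formula n) → Set (lsuc (a ⊔ ℓ))
IsFormulaPartition a ℓ {k} {n} Θ =
  (∀ (M : Structure a ℓ) (ρ : Vector (Structure.Carrier M) n) →
      Σ (Fin k) (λ j → Sat M (Θ j) ρ))
  × (∀ (i j : Fin k) → i ≢ j → ∀ (M : Structure a ℓ) (ρ : Vector (Structure.Carrier M) n) →
      ¬ (Sat M (Θ i) ρ × Sat M (Θ j) ρ))

module RingDefs {c ℓ : Level} (R : CommutativeRing c ℓ) where
  open CommutativeRing R hiding (zero)

  ringStructure : Structure c ℓ
  ringStructure = record
    { Carrier = Carrier ; _≈_ = _≈_ ; isEquivalence = isEquivalence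
    ; _+_ = _+_ ; _*_ = _*_ ; 0# = 0# ; 1# = 1#
    ; +-cong = +-cong ; *-cong = *-cong }

  -- The localisation R_e ≅ R/(1-e)R: carrier R, with a ~ b iff
  -- a - b ∈ (1-e)R, i.e. (for e idempotent) e·a = e·b.  The image (f)_e of f
  -- is f itself.
  _≈[_]_ : Carrier → Carrier → Carrier → Set ℓ
  x ≈[ e ] y = (e * x) ≈ (e * y)

  locStructure : Carrier → Structure c ℓ
  locStructure e = record
    { Carrier = Carrier ; _≈_ = λ x y → x ≈[ e ] y
    ; isEquivalence = record { refl = refl ; sym = sym ; trans = trans }
    ; _+_ = _+_ ; _*_ = _*_ ; 0# = 0# ; 1# = 1#
    ; +-cong = λ {x} {y} {u} {v} p q → begin
        e * (x + u)     ≈⟨ distribˡ e x u ⟩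
        e * x + e * u   ≈⟨ +-cong p q ⟩
        e * y + e * v   ≈⟨ sym (distribˡ e y v) ⟩
        e * (y + v)     ∎
    ; *-cong = λ {x} {y} {u} {v} p q → begin
        e * (x * u)     ≈⟨ sym (*-assoc e x u) ⟩
        (e * x) * u     ≈⟨ *-congʳ p ⟩
        (e * y) * u     ≈⟨ *-assoc e y u ⟩
        e * (y * u)     ≈⟨ *-congˡ (*-comm y u) ⟩
        e * (u * y)     ≈⟨ sym (*-assoc e u y) ⟩
        (e * u) * y     ≈⟨ *-congʳ q ⟩
        (e * v) * y     ≈⟨ *-assoc e v y ⟩
        e * (v * y)     ≈⟨ *-congˡ (*-comm v y) ⟩
        e * (y * v)     ∎ }
    where open SetoidReasoning setoid

  IsIdem : Carrier → Set ℓ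
  IsIdem x = (x * x) ≈ x

  _≤B_ : Carrier → Carrier → Set ℓ
  e ≤B f = (e * f) ≈ e

  _∧B_ : Carrier → Carrier → Carrier
  e ∧B f = e * f

  _∨B_ : Carrier → Carrier → Carrier
  e ∨B f = (e + f) - (e * f)

  ¬B_ : Carrier → Carrier
  ¬B e = 1# - e

  Atom : Carrier → Set (c ⊔ ℓ)
  Atom e = IsIdem e × ¬ (e ≈ 0#)
         × (∀ f → IsIdem f → f ≤B e → ¬ (f ≈ 0#) → f ≈ e)

  IsSupOfAtoms : (Carrier → Set (c ⊔ ℓ)) → Carrier → Set (c ⊔ ℓ)
  IsSupOfAtoms P b =
    IsIdem b
    × (∀ e → Atom e → P e → e ≤B b)
    × (∀ u → IsIdem u → (∀ e → Atom e → P e → e ≤B u) → b ≤B u)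

  IsBoolVal : ∀ {n} → Formula n → Vector Carrier n → Carrier → Set (c ⊔ ℓ)
  IsBoolVal Θ ρ b = IsSupOfAtoms (λ e → Sat (locStructure e) Θ ρ) b

  joinL : List Carrier → Carrier
  joinL []       = 0#
  joinL (x ∷ xs) = x ∨B joinL xs

  bigJoin : ∀ {k} → (Fin k → Carrier) → Carrier
  bigJoin {ℕ.zero}   Y = 0#
  bigJoin {nsuc k}   Y = Y Fin.zero ∨B bigJoin (λ i → Y (suc i))

  Finite : Carrier → Set (c ⊔ ℓ)
  Finite e = Σ (List Carrier) (λ es → All Atom es × (joinL es ≈ e))

  IsBPartition : ∀ {k} → (Fin k → Carrier) → Set ℓ
  IsBPartition {k} Y =
    (∀ j → IsIdem (Y j)) × (bigJoin Y ≈ 1#)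
    × (∀ (i j : Fin k) → i ≢ j → (Y i ∧B Y j) ≈ 0#)

  -- The axioms.  `bv Θ ρ` stands for [[Θ(ρ)]].
  Axiom1 : Set (c ⊔ ℓ)
  Axiom1 = ∀ e → IsIdem e → ¬ (e ≈ 0#) → Σ Carrier (λ a → Atom a × (a ≤B e))

  Axiom2 : (∀ {n} → Formula n → Vector Carrier n → Carrier) → Set (c ⊔ ℓ)
  Axiom2 bv = ∀ {n} (Θ : Formula n) (ρ : Vector Carrier n) → IsBoolVal Θ ρ (bv Θ ρ)

  Axiom3 : (∀ {n} → Formula n → Vector Carrier n → Carrier) → Set (c ⊔ ℓ)
  Axiom3 bv = ∀ {n} (s t : Term n) (ρ : Vector Carrier n) →
    (Sat ringStructure (s `≈ t) ρ → bv (s `≈ t) ρ ≈ 1#)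
    × (bv (s `≈ t) ρ ≈ 1# → Sat ringStructure (s `≈ t) ρ)

  -- Θ(x_1,...,x_n,w) : Formula (suc n) with w = var zero.
  Axiom4⁺ : Formula 1 → (∀ {n} → Formula n → Vector Carrier n → Carrier) → Set (c ⊔ ℓ)
  Axiom4⁺ φ bv = ∀ {n} (Θ : Formula (nsuc n)) (f : Vector Carrier n) →
    Σ Carrier (λ g →
      Finite (bv (`∃ Θ) f ∧B (¬B bv (`∃ (atW φ `∧ Θ)) f))
      → Finite (bv (`∃ Θ) f ∧B (¬B bv Θ (g ∷ᵥ f))))

module Submission where

-- Encode the k cases in ONE formula with the idempotents Y_j as extra
-- parameters:  Ψ(w, f, Y) = ⋁_j (Y_j = 1 ∧ Θ_j(f, w)).  At an atom a ≤ Y_j the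
-- equation Y_i = 1 holds in R_a exactly for i = j (the Y_j are disjoint), so
-- in R_a the formula Ψ says precisely Θ_j(f, w).  Hence the exceptional element
-- [[∃Ψ]] ∧ ¬[[∃(φ ∧ Ψ)]] only contains atoms from the finitely many atoms of
-- the elements Y_j ∧ ¬[[∃(φ ∧ Θ_j)]], so it is finite, and Axiom 4⁺ yields a g
-- which witnesses Ψ at all but finitely many atoms of [[∃Ψ]].  At each of those
-- finitely many atoms e we splice in a local witness h, g ↦ g(1-e) + eh; the
-- result witnesses Ψ at every atom of [[∃Ψ]], hence Θ_j at every atom below
-- Y_j, and by atomicity Y_j ≤ [[Θ_j(f, g)]].

open import Defs
open import Level using (_⊔_; Lift; lift)
open import Data.Nat using (ℕ) renaming (suc to nsuc; _+_ to _+ℕ_)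
open import Data.Fin using (Fin; zero; suc; _↑ˡ_; _↑ʳ_; _≟_)
open import Data.Fin.Properties using (splitAt-↑ˡ; splitAt-↑ʳ)
open import Data.Product using (Σ; _,_; proj₁; proj₂)
open import Data.Sum using (_⊎_; inj₁; inj₂; [_,_]′)
open import Data.List using (List; []; _∷_; filter; concat; tabulate)
open import Data.List.Relation.Unary.All using (All; []; _∷_)
import Data.List.Relation.Unary.All as All
import Data.List.Relation.Unary.All.Properties as All
open import Data.List.Relation.Unary.Any using (Any; here; there)
import Data.List.Relation.Unary.Any as Any
import Data.List.Relation.Unary.Any.Properties as Any
open import Data.Vec.Functional using (Vector) renaming (_∷_ to _∷ᵥ_; _++_ to _++ᵥ_)
open import Relation.Nullary using (¬_; Dec; yes; no)
open import Relation.Binary using (IsEquivalence)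
open import Relation.Binary.PropositionalEquality as P using (_≡_)
open import Data.Empty using (⊥-elim)
open import Algebra.Bundles using (CommutativeRing)
open import Axiom.ExcludedMiddle using (ExcludedMiddle)
import Relation.Binary.Reasoning.Setoid as SetoidReasoning

⋁ : ∀ {n k} → (Fin k → Formula n) → Formula n
⋁ {k = ℕ.zero} F = `¬ (`0 `≈ `0)
⋁ {k = nsuc k} F = F zero `∨ ⋁ (λ i → F (suc i))

module Satisfaction {a ℓ} (M : Structure a ℓ) where
  open Structure M
  open IsEquivalence isEquivalence

  _≋_ : ∀ {n} → Vector Carrier n → Vector Carrier n → Set ℓ
  ρ ≋ σ = ∀ i → ρ i ≈ σ i

  ≋-cons : ∀ {n} {ρ σ : Vector Carrier n} x → ρ ≋ σ → (x ∷ᵥ ρ) ≋ (x ∷ᵥ σ)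
  ≋-cons x p zero    = refl
  ≋-cons x p (suc i) = p i

  evalT-cong : ∀ {n} {ρ σ : Vector Carrier n} → ρ ≋ σ → ∀ t → evalT M ρ t ≈ evalT M σ t
  evalT-cong p (var i)  = p i
  evalT-cong p `0       = refl
  evalT-cong p `1       = refl
  evalT-cong p (s `+ t) = +-cong (evalT-cong p s) (evalT-cong p t)
  evalT-cong p (s `* t) = *-cong (evalT-cong p s) (evalT-cong p t)

  sat-cong : ∀ {n} (φ : Formula n) {ρ σ : Vector Carrier n} → ρ ≋ σ → Sat M φ ρ → Sat M φ σ
  sat-cong (s `≈ t) p (lift q)  = lift (trans (sym (evalT-cong p s)) (trans q (evalT-cong p t)))
  sat-cong (`¬ φ)   p h         = λ s → h (sat-cong φ (λ i → sym (p i)) s)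
  sat-cong (φ `∧ ψ) p (x , y)   = sat-cong φ p x , sat-cong ψ p y
  sat-cong (φ `∨ ψ) p (inj₁ x)  = inj₁ (sat-cong φ p x)
  sat-cong (φ `∨ ψ) p (inj₂ y)  = inj₂ (sat-cong ψ p y)
  sat-cong (`∃ φ)   p (x , s)   = x , sat-cong φ (≋-cons x p) s
  sat-cong (`∀ φ)   p h         = λ x → sat-cong φ (≋-cons x p) (h x)

  ≋-liftRen : ∀ {n k} {r : Fin n → Fin k} {ρ σ} x →
              (λ i → ρ (r i)) ≋ σ → (λ i → (x ∷ᵥ ρ) (liftRen r i)) ≋ (x ∷ᵥ σ)
  ≋-liftRen x p zero    = refl
  ≋-liftRen x p (suc i) = p i

  evalT-ren : ∀ {n k} {r : Fin n → Fin k} {ρ σ} → (λ i → ρ (r i)) ≋ σ →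
              ∀ t → evalT M ρ (renT r t) ≈ evalT M σ t
  evalT-ren p (var i)  = p i
  evalT-ren p `0       = refl
  evalT-ren p `1       = refl
  evalT-ren p (s `+ t) = +-cong (evalT-ren p s) (evalT-ren p t)
  evalT-ren p (s `* t) = *-cong (evalT-ren p s) (evalT-ren p t)

  sat-ren→ : ∀ {n k} (φ : Formula n) {r : Fin n → Fin k} {ρ σ} →
             (λ i → ρ (r i)) ≋ σ → Sat M (renF r φ) ρ → Sat M φ σ
  sat-ren← : ∀ {n k} (φ : Formula n) {r : Fin n → Fin k} {ρ σ} →
             (λ i → ρ (r i)) ≋ σ → Sat M φ σ → Sat M (renF r φ) ρ
  sat-ren→ (s `≈ t) p (lift q) = lift (trans (sym (evalT-ren p s)) (trans q (evalT-ren p t)))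
  sat-ren→ (`¬ φ)   p h        = λ s → h (sat-ren← φ p s)
  sat-ren→ (φ `∧ ψ) p (x , y)  = sat-ren→ φ p x , sat-ren→ ψ p y
  sat-ren→ (φ `∨ ψ) p (inj₁ x) = inj₁ (sat-ren→ φ p x)
  sat-ren→ (φ `∨ ψ) p (inj₂ y) = inj₂ (sat-ren→ ψ p y)
  sat-ren→ (`∃ φ)   p (x , s)  = x , sat-ren→ φ (≋-liftRen x p) s
  sat-ren→ (`∀ φ)   p h        = λ x → sat-ren→ φ (≋-liftRen x p) (h x)
  sat-ren← (s `≈ t) p (lift q) = lift (trans (evalT-ren p s) (trans q (sym (evalT-ren p t))))
  sat-ren← (`¬ φ)   p h        = λ s → h (sat-ren→ φ p s)
  sat-ren← (φ `∧ ψ) p (x , y)  = sat-ren← φ p x , sat-ren← ψ p y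
  sat-ren← (φ `∨ ψ) p (inj₁ x) = inj₁ (sat-ren← φ p x)
  sat-ren← (φ `∨ ψ) p (inj₂ y) = inj₂ (sat-ren← ψ p y)
  sat-ren← (`∃ φ)   p (x , s)  = x , sat-ren← φ (≋-liftRen x p) s
  sat-ren← (`∀ φ)   p h        = λ x → sat-ren← φ (≋-liftRen x p) (h x)

  sat-⋁⁻ : ∀ {n k} (F : Fin k → Formula n) {ρ} → Sat M (⋁ F) ρ → Σ (Fin k) (λ j → Sat M (F j) ρ)
  sat-⋁⁻ {k = ℕ.zero} F h with () ← h (lift refl)
  sat-⋁⁻ {k = nsuc k} F (inj₁ x) = zero , x
  sat-⋁⁻ {k = nsuc k} F (inj₂ y) with sat-⋁⁻ (λ i → F (suc i)) y
  ... | j , s = suc j , s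

  sat-⋁⁺ : ∀ {n k} (F : Fin k → Formula n) {ρ} j → Sat M (F j) ρ → Sat M (⋁ F) ρ
  sat-⋁⁺ {k = nsuc k} F zero    s = inj₁ s
  sat-⋁⁺ {k = nsuc k} F (suc j) s = inj₂ (sat-⋁⁺ (λ i → F (suc i)) j s)

module IdempotentOrder {c ℓ} (R : CommutativeRing c ℓ) where
  open CommutativeRing R hiding (zero)
  open RingDefs R
  open import Algebra.Properties.Ring ring using (x[y-z]≈xy-xz; [y-z]x≈yx-zx)
  open import Algebra.Properties.Group +-group using (ε⁻¹≈ε)
  open import Algebra.Properties.AbelianGroup +-abelianGroup using (xyx⁻¹≈y)
  open import Algebra.Properties.CommutativeSemigroup *-commutativeSemigroup
    using (interchange; x∙yz≈y∙xz; xy∙z≈xz∙y)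
  open SetoidReasoning setoid

  -‿cong₂ : ∀ {x y u v} → x ≈ y → u ≈ v → (x - u) ≈ (y - v)
  -‿cong₂ p q = +-cong p (-‿cong q)

  x-0≈x : ∀ x → (x - 0#) ≈ x
  x-0≈x x = trans (+-congˡ ε⁻¹≈ε) (+-identityʳ x)

  x+y-y≈x : ∀ x y → ((x + y) - y) ≈ x
  x+y-y≈x x y = trans (-‿cong₂ (+-comm x y) refl) (xyx⁻¹≈y y x)

  x[1-y]≈x-xy : ∀ x y → (x * (1# - y)) ≈ (x - x * y)
  x[1-y]≈x-xy x y = trans (x[y-z]≈xy-xz x 1# y) (-‿cong₂ (*-identityʳ x) refl)

  *-∨ : ∀ a x y → (a * (x ∨B y)) ≈ ((a * x + a * y) - (a * x) * y)
  *-∨ a x y = trans (x[y-z]≈xy-xz a (x + y) (x * y)) (-‿cong₂ (distribˡ a x y) (sym (*-assoc a x y)))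

  ∧-idem : ∀ {x y} → IsIdem x → IsIdem y → IsIdem (x ∧B y)
  ∧-idem {x} {y} px py = trans (interchange x y x y) (*-cong px py)

  y∧¬y≈0 : ∀ {y} → IsIdem y → (y ∧B (¬B y)) ≈ 0#
  y∧¬y≈0 {y} py = trans (x[1-y]≈x-xy y y) (trans (-‿cong₂ refl py) (-‿inverseʳ y))

  ¬-idem : ∀ {y} → IsIdem y → IsIdem (¬B y)
  ¬-idem {y} py = begin
    (1# - y) * (1# - y)           ≈⟨ [y-z]x≈yx-zx (1# - y) 1# y ⟩
    1# * (1# - y) - y * (1# - y)  ≈⟨ -‿cong₂ (*-identityˡ _) (y∧¬y≈0 py) ⟩
    (1# - y) - 0#                 ≈⟨ x-0≈x _ ⟩
    1# - y                        ∎

  ≤-trans : ∀ {a b d} → a ≤B b → b ≤B d → a ≤B d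
  ≤-trans {a} {b} {d} p q = begin
    a * d        ≈⟨ *-congʳ (sym p) ⟩
    (a * b) * d  ≈⟨ *-assoc a b d ⟩
    a * (b * d)  ≈⟨ *-congˡ q ⟩
    a * b        ≈⟨ p ⟩
    a            ∎

  ≤-respˡ : ∀ {a a' b} → a ≈ a' → a ≤B b → a' ≤B b
  ≤-respˡ p q = trans (*-congʳ (sym p)) (trans q p)

  ≤-respʳ : ∀ {a b b'} → b ≈ b' → a ≤B b → a ≤B b'
  ≤-respʳ p q = trans (*-congˡ (sym p)) q

  ≤-antisym : ∀ {a b} → a ≤B b → b ≤B a → a ≈ b
  ≤-antisym {a} {b} p q = trans (sym p) (trans (*-comm a b) q)

  ≤-∧ : ∀ {a b d} → a ≤B b → a ≤B d → a ≤B (b ∧B d)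
  ≤-∧ {a} {b} {d} p q = trans (sym (*-assoc a b d)) (trans (*-congʳ p) q)

  ∧-≤ˡ : ∀ {b d} → IsIdem b → (b ∧B d) ≤B b
  ∧-≤ˡ {b} {d} pb = trans (xy∙z≈xz∙y b d b) (*-congʳ pb)

  ∧-≤ʳ : ∀ {b d} → IsIdem d → (b ∧B d) ≤B d
  ∧-≤ʳ {b} {d} pd = trans (*-assoc b d d) (*-congˡ pd)

  ≤0⇒≈0 : ∀ {a} → a ≤B 0# → a ≈ 0#
  ≤0⇒≈0 {a} p = trans (sym p) (zeroʳ a)

  disjoint⇒≤¬ : ∀ {a b} → (a * b) ≈ 0# → a ≤B (¬B b)
  disjoint⇒≤¬ {a} {b} p = trans (x[1-y]≈x-xy a b) (trans (-‿cong₂ refl p) (x-0≈x a))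

  ≤¬⇒disjoint : ∀ {a b} → IsIdem b → a ≤B (¬B b) → (a * b) ≈ 0#
  ≤¬⇒disjoint {a} {b} pb p = begin
    a * b                ≈⟨ *-congʳ (sym p) ⟩
    (a * (1# - b)) * b   ≈⟨ xy∙z≈xz∙y a (1# - b) b ⟩
    (a * b) * (1# - b)   ≈⟨ *-assoc a b (1# - b) ⟩
    a * (b * (1# - b))   ≈⟨ *-congˡ (y∧¬y≈0 pb) ⟩
    a * 0#               ≈⟨ zeroʳ a ⟩
    0#                   ∎

  ≤∨ˡ : ∀ {x y} → IsIdem x → x ≤B (x ∨B y)
  ≤∨ˡ {x} {y} px = trans (*-∨ x x y) (trans (-‿cong₂ (+-congʳ px) (*-congʳ px)) (x+y-y≈x x (x * y)))

  ≤∨ʳ : ∀ {x y} → IsIdem y → y ≤B (x ∨B y)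
  ≤∨ʳ {x} {y} py = begin
    y * (x ∨B y)                   ≈⟨ *-∨ y x y ⟩
    (y * x + y * y) - (y * x) * y  ≈⟨ -‿cong₂ (+-congˡ py) (trans (xy∙z≈xz∙y y x y) (*-congʳ py)) ⟩
    (y * x + y) - y * x            ≈⟨ xyx⁻¹≈y (y * x) y ⟩
    y                              ∎

  ∨-≤ : ∀ {x y z} → x ≤B z → y ≤B z → (x ∨B y) ≤B z
  ∨-≤ {x} {y} {z} p q = begin
    (x ∨B y) * z                   ≈⟨ *-comm _ z ⟩
    z * (x ∨B y)                   ≈⟨ *-∨ z x y ⟩
    (z * x + z * y) - (z * x) * y  ≈⟨ -‿cong₂ (+-cong zx≈x (trans (*-comm z y) q)) (*-congʳ zx≈x) ⟩
    (x + y) - x * y                ∎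
    where
    zx≈x : (z * x) ≈ x
    zx≈x = trans (*-comm z x) p

  ∨-idem : ∀ {x y} → IsIdem x → IsIdem y → IsIdem (x ∨B y)
  ∨-idem px py = ∨-≤ (≤∨ˡ px) (≤∨ʳ py)

  splice : Carrier → Carrier → Carrier → Carrier
  splice g e h = g * (1# - e) + e * h

  *-splice : ∀ a g e h → (a * splice g e h) ≈ (g * (a * (1# - e)) + (a * e) * h)
  *-splice a g e h = trans (distribˡ a _ _) (+-cong (x∙yz≈y∙xz a g (1# - e)) (sym (*-assoc a e h)))

  splice-inside : ∀ {a e} g h → a ≤B e → (a * splice g e h) ≈ (a * h)
  splice-inside {a} {e} g h a≤e = begin
    a * splice g e h                  ≈⟨ *-splice a g e h ⟩
    g * (a * (1# - e)) + (a * e) * h  ≈⟨ +-cong (*-congˡ a[1-e]≈0) (*-congʳ a≤e) ⟩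
    g * 0# + a * h                    ≈⟨ +-congʳ (zeroʳ g) ⟩
    0# + a * h                        ≈⟨ +-identityˡ _ ⟩
    a * h                             ∎
    where
    a[1-e]≈0 : (a * (1# - e)) ≈ 0#
    a[1-e]≈0 = trans (x[1-y]≈x-xy a e) (trans (-‿cong₂ refl a≤e) (-‿inverseʳ a))

  splice-outside : ∀ {a e} g h → (a * e) ≈ 0# → (a * splice g e h) ≈ (a * g)
  splice-outside {a} {e} g h ae≈0 = begin
    a * splice g e h                  ≈⟨ *-splice a g e h ⟩
    g * (a * (1# - e)) + (a * e) * h  ≈⟨ +-cong (*-congˡ (disjoint⇒≤¬ ae≈0)) (trans (*-congʳ ae≈0) (zeroˡ h)) ⟩
    g * a + 0#                        ≈⟨ +-identityʳ _ ⟩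
    g * a                             ≈⟨ *-comm g a ⟩
    a * g                             ∎

  evalT-loc : ∀ {n} e (ρ : Vector Carrier n) t → evalT (locStructure e) ρ t ≡ evalT ringStructure ρ t
  evalT-loc e ρ (var i)  = P.refl
  evalT-loc e ρ `0       = P.refl
  evalT-loc e ρ `1       = P.refl
  evalT-loc e ρ (s `+ t) = P.cong₂ _+_ (evalT-loc e ρ s) (evalT-loc e ρ t)
  evalT-loc e ρ (s `* t) = P.cong₂ _*_ (evalT-loc e ρ s) (evalT-loc e ρ t)

  sat-loc-resp : ∀ {n} (φ : Formula n) (ρ : Vector Carrier n) {e a} → e ≈ a →
                 Sat (locStructure e) φ ρ → Sat (locStructure a) φ ρ
  sat-loc-resp (s `≈ t) ρ {e} {a} e≈a (lift q) = lift (begin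
    a * evalT (locStructure a) ρ s  ≈⟨ *-cong (sym e≈a) (reflexive (P.trans (evalT-loc a ρ s) (P.sym (evalT-loc e ρ s)))) ⟩
    e * evalT (locStructure e) ρ s  ≈⟨ q ⟩
    e * evalT (locStructure e) ρ t  ≈⟨ *-cong e≈a (reflexive (P.trans (evalT-loc e ρ t) (P.sym (evalT-loc a ρ t)))) ⟩
    a * evalT (locStructure a) ρ t  ∎)
  sat-loc-resp (`¬ φ)   ρ p h        = λ s → h (sat-loc-resp φ ρ (sym p) s)
  sat-loc-resp (φ `∧ ψ) ρ p (x , y)  = sat-loc-resp φ ρ p x , sat-loc-resp ψ ρ p y
  sat-loc-resp (φ `∨ ψ) ρ p (inj₁ x) = inj₁ (sat-loc-resp φ ρ p x)
  sat-loc-resp (φ `∨ ψ) ρ p (inj₂ y) = inj₂ (sat-loc-resp ψ ρ p y)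
  sat-loc-resp (`∃ φ)   ρ p (x , s)  = x , sat-loc-resp φ (x ∷ᵥ ρ) p s
  sat-loc-resp (`∀ φ)   ρ p h        = λ x → sat-loc-resp φ (x ∷ᵥ ρ) p (h x)

  sat-loc-head : ∀ {n} (Θ : Formula (nsuc n)) (f : Vector Carrier n) {a x y} →
                 (a * x) ≈ (a * y) → Sat (locStructure a) Θ (x ∷ᵥ f) → Sat (locStructure a) Θ (y ∷ᵥ f)
  sat-loc-head Θ f {a} ax≈ay = Satisfaction.sat-cong (locStructure a) Θ λ
    { zero → ax≈ay ; (suc i) → refl }

-- Atoms and Boolean values.  Classical: an atom decides every idempotent.
module Atomic {c ℓ} (R : CommutativeRing c ℓ) (em : ExcludedMiddle (c ⊔ ℓ)) where
  open CommutativeRing R hiding (zero)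
  open RingDefs R
  open IdempotentOrder R
  open import Algebra.Properties.Group +-group using (x∙y⁻¹≈ε⇒x≈y)
  open import Algebra.Properties.AbelianGroup +-abelianGroup using (xyx⁻¹≈y)
  open SetoidReasoning setoid

  decide : (A : Set ℓ) → Dec A
  decide A with em {Lift c A}
  ... | yes (lift x) = yes x
  ... | no ¬x        = no (λ x → ¬x (lift x))

  atom-idem : ∀ {a} → Atom a → IsIdem a
  atom-idem = proj₁

  atom≢0 : ∀ {a} → Atom a → ¬ (a ≈ 0#)
  atom≢0 at = proj₁ (proj₂ at)

  dichotomy : ∀ {a y} → Atom a → IsIdem y → (a ≤B y) ⊎ ((a * y) ≈ 0#)
  dichotomy {a} {y} at py with decide ((a * y) ≈ 0#)
  ... | yes ay≈0 = inj₂ ay≈0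
  ... | no ay≢0  = inj₁ (proj₂ (proj₂ at) (a * y) (∧-idem (atom-idem at) py) (∧-≤ˡ (atom-idem at)) ay≢0)

  atom≤atom⇒≈ : ∀ {a e} → Atom a → Atom e → a ≤B e → a ≈ e
  atom≤atom⇒≈ at ae a≤e = proj₂ (proj₂ ae) _ (atom-idem at) a≤e (atom≢0 at)

  atom≤∨ : ∀ {a x y} → Atom a → IsIdem x → a ≤B (x ∨B y) → (a ≤B x) ⊎ (a ≤B y)
  atom≤∨ {a} {x} {y} at px a≤x∨y with dichotomy at px
  ... | inj₁ a≤x  = inj₁ a≤x
  ... | inj₂ ax≈0 = inj₂ (begin
    a * y                          ≈⟨ sym (xyx⁻¹≈y (a * x) (a * y)) ⟩
    (a * x + a * y) - a * x        ≈⟨ -‿cong₂ refl (sym (trans (trans (*-congʳ ax≈0) (zeroˡ y)) (sym ax≈0))) ⟩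
    (a * x + a * y) - (a * x) * y  ≈⟨ sym (*-∨ a x y) ⟩
    a * (x ∨B y)                   ≈⟨ a≤x∨y ⟩
    a                              ∎)

  atom≤bigJoin : ∀ {k} {Y : Fin k → Carrier} → (∀ j → IsIdem (Y j)) →
                 ∀ {a} → Atom a → a ≤B bigJoin Y → Σ (Fin k) (λ j → a ≤B Y j)
  atom≤bigJoin {ℕ.zero} pY at a≤0 = ⊥-elim (atom≢0 at (≤0⇒≈0 a≤0))
  atom≤bigJoin {nsuc k} pY at a≤Y with atom≤∨ at (pY zero) a≤Y
  ... | inj₁ a≤Y₀ = zero , a≤Y₀
  ... | inj₂ a≤rest with atom≤bigJoin (λ i → pY (suc i)) at a≤rest
  ...   | j , a≤Yj = suc j , a≤Yj

  atom≤joinL : ∀ {a es} → Atom a → All Atom es → a ≤B joinL es → Any (a ≈_) es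
  atom≤joinL at []         a≤0 = ⊥-elim (atom≢0 at (≤0⇒≈0 a≤0))
  atom≤joinL at (ae ∷ aes) a≤j with atom≤∨ at (atom-idem ae) a≤j
  ... | inj₁ a≤e    = here (atom≤atom⇒≈ at ae a≤e)
  ... | inj₂ a≤rest = there (atom≤joinL at aes a≤rest)

  joinL-idem : ∀ {es} → All IsIdem es → IsIdem (joinL es)
  joinL-idem []       = zeroˡ 0#
  joinL-idem (p ∷ ps) = ∨-idem p (joinL-idem ps)

  joinL-upper : ∀ {es} → All IsIdem es → All (_≤B joinL es) es
  joinL-upper []       = []
  joinL-upper (p ∷ ps) = ≤∨ˡ p ∷ All.map (λ q → ≤-trans q (≤∨ʳ (joinL-idem ps))) (joinL-upper ps)

  joinL-least : ∀ {es X} → All (_≤B X) es → joinL es ≤B X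
  joinL-least []       = zeroˡ _
  joinL-least (p ∷ ps) = ∨-≤ p (joinL-least ps)

  ≤-by-atoms : Axiom1 → ∀ {y b} → IsIdem y → IsIdem b → (∀ {a} → Atom a → a ≤B y → a ≤B b) → y ≤B b
  ≤-by-atoms atomic {y} {b} py pb below with decide ((y * (1# - b)) ≈ 0#)
  ... | yes y¬b≈0 = sym (x∙y⁻¹≈ε⇒x≈y y (y * b) (trans (sym (x[1-y]≈x-xy y b)) y¬b≈0))
  ... | no y¬b≢0 with atomic (y * (1# - b)) (∧-idem py (¬-idem pb)) y¬b≢0
  ...   | a , at , a≤y¬b = ⊥-elim (atom≢0 at (begin
          a      ≈⟨ sym (below at (≤-trans a≤y¬b (∧-≤ˡ py))) ⟩
          a * b  ≈⟨ ≤¬⇒disjoint pb (≤-trans a≤y¬b (∧-≤ʳ (¬-idem pb))) ⟩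
          0#     ∎))

  -- An idempotent whose atoms all occur in a given list of atoms is finite:
  -- it is the join of the list entries lying below it.
  finite-if-covered : Axiom1 → ∀ {X} → IsIdem X → {L : List Carrier} → All Atom L →
                      (∀ {a} → Atom a → a ≤B X → Any (a ≈_) L) → Finite X
  finite-if-covered atomic {X} pX {L} atoms covers =
    L' , L'-atoms , ≤-antisym (joinL-least (All.all-filter below? L)) X≤joinL'
    where
    below? : (x : Carrier) → Dec (x ≤B X)
    below? x = decide (x ≤B X)
    L' : List Carrier
    L' = filter below? L
    L'-atoms : All Atom L'
    L'-atoms = All.filter⁺ below? atoms
    X≤joinL' : X ≤B joinL L'
    X≤joinL' = ≤-by-atoms atomic pX (joinL-idem (All.map atom-idem L'-atoms)) λ {a} at a≤X →
      [ (λ a∈L' → let (e≤ , a≈e) = All.lookupAny (joinL-upper (All.map atom-idem L'-atoms)) a∈L'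
                  in ≤-respˡ (sym a≈e) e≤)
      , (λ e≰X → ⊥-elim (e≰X (≤-respˡ (Any.lookup-result (covers at a≤X)) a≤X))) ]′
      (Any.filter⁺ below? (covers at a≤X))

  module BooleanValue {n} (Θ : Formula n) (ρ : Vector Carrier n) {b} (isBV : IsBoolVal Θ ρ b) where

    sat⇒≤ : ∀ {a} → Atom a → Sat (locStructure a) Θ ρ → a ≤B b
    sat⇒≤ at s = proj₁ (proj₂ isBV) _ at s

    -- If a ≤ b but R_a ⊭ Θ then all atoms satisfying Θ lie below ¬a, hence so does b.
    ≤⇒sat : ∀ {a} → Atom a → a ≤B b → Sat (locStructure a) Θ ρ
    ≤⇒sat {a} at a≤b with em {Sat (locStructure a) Θ ρ}
    ... | yes s  = s
    ... | no ¬s  = ⊥-elim (atom≢0 at (begin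
      a      ≈⟨ sym a≤b ⟩
      a * b  ≈⟨ *-comm a b ⟩
      b * a  ≈⟨ ≤¬⇒disjoint (atom-idem at) b≤¬a ⟩
      0#     ∎))
      where
      sat-atoms≤¬a : ∀ e → Atom e → Sat (locStructure e) Θ ρ → e ≤B (¬B a)
      sat-atoms≤¬a e ae s with dichotomy ae (atom-idem at)
      ... | inj₁ e≤a  = ⊥-elim (¬s (sat-loc-resp Θ ρ (atom≤atom⇒≈ ae at e≤a) s))
      ... | inj₂ ea≈0 = disjoint⇒≤¬ ea≈0
      b≤¬a : b ≤B (¬B a)
      b≤¬a = proj₂ (proj₂ isBV) _ (¬-idem (atom-idem at)) sat-atoms≤¬a

    ¬sat⇒≤¬ : ∀ {a} → Atom a → ¬ Sat (locStructure a) Θ ρ → a ≤B (¬B b)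
    ¬sat⇒≤¬ at ¬s with dichotomy at (proj₁ isBV)
    ... | inj₁ a≤b  = ⊥-elim (¬s (≤⇒sat at a≤b))
    ... | inj₂ ab≈0 = disjoint⇒≤¬ ab≈0

    ≤¬⇒¬sat : ∀ {a} → Atom a → a ≤B (¬B b) → ¬ Sat (locStructure a) Θ ρ
    ≤¬⇒¬sat at a≤¬b s = atom≢0 at (trans (sym (sat⇒≤ at s)) (≤¬⇒disjoint (proj₁ isBV) a≤¬b))

  -- Splicing local witnesses into g at finitely many atoms.  Q a x reads
  -- "x is good at the atom a"; it may only depend on a·x and on a up to ≈.
  module Splicing (Q : Carrier → Carrier → Set (c ⊔ ℓ))
      (Q-local : ∀ {a x y} → (a * x) ≈ (a * y) → Q a x → Q a y)
      (Q-resp : ∀ {e a x} → e ≈ a → Q e x → Q a x) where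

    Witnessed : Carrier → Set (c ⊔ ℓ)
    Witnessed e = Σ Carrier (Q e)

    spliceAll : ∀ {es} → All Witnessed es → Carrier → Carrier
    spliceAll []                    g = g
    spliceAll {e ∷ _} ((h , _) ∷ ws) g = splice (spliceAll ws g) e h

    spliceAll-good : ∀ {es} → All Atom es → (ws : All Witnessed es) → ∀ {g a} → Atom a →
                     Q a g ⊎ Any (a ≈_) es → Q a (spliceAll ws g)
    spliceAll-good []         []              at (inj₁ q)  = q
    spliceAll-good []         []              at (inj₂ ())
    spliceAll-good {e ∷ es} (ae ∷ aes) ((h , qh) ∷ ws) {g} {a} at good with dichotomy at (atom-idem ae)
    ... | inj₁ a≤e  = Q-local (sym (splice-inside (spliceAll ws g) h a≤e))
                              (Q-resp (sym (atom≤atom⇒≈ at ae a≤e)) qh)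
    ... | inj₂ ae≈0 = Q-local (sym (splice-outside (spliceAll ws g) h ae≈0))
                              (spliceAll-good aes ws at (not-e good))
      where
      not-e : Q a g ⊎ Any (a ≈_) (e ∷ es) → Q a g ⊎ Any (a ≈_) es
      not-e (inj₁ q)          = inj₁ q
      not-e (inj₂ (here a≈e)) = ⊥-elim (atom≢0 at (trans (sym (trans (*-congˡ (sym a≈e)) (atom-idem at))) ae≈0))
      not-e (inj₂ (there i))  = inj₂ i

-- Axiom 4⁺ with its finite exceptional set removed: a single g witnessing Θ
-- at every atom where some witness exists.
module UniformWitness {c ℓ} (R : CommutativeRing c ℓ) (em : ExcludedMiddle (c ⊔ ℓ))
    (φ : Formula 1) (bv : ∀ {n} → Formula n → Vector (CommutativeRing.Carrier R) n → CommutativeRing.Carrier R)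
    (ax2 : RingDefs.Axiom2 R bv) (ax4 : RingDefs.Axiom4⁺ R φ bv) where
  open CommutativeRing R hiding (zero)
  open RingDefs R
  open IdempotentOrder R
  open Atomic R em

  uniform-witness : ∀ {n} (Θ : Formula (nsuc n)) (f : Vector Carrier n) →
    Finite (bv (`∃ Θ) f ∧B (¬B bv (`∃ (atW φ `∧ Θ)) f)) →
    Σ Carrier λ g → ∀ {a} → Atom a → Sat (locStructure a) (`∃ Θ) f → Sat (locStructure a) Θ (g ∷ᵥ f)
  uniform-witness Θ f fin = spliceAll witnesses g₀ , good
    where
    open Splicing (λ a x → Sat (locStructure a) Θ (x ∷ᵥ f)) (sat-loc-head Θ f) (sat-loc-resp Θ _)
    open BooleanValue (`∃ Θ) f (ax2 (`∃ Θ) f) using () renaming (sat⇒≤ to ∃-sat⇒≤; ≤⇒sat to ∃-≤⇒sat)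
    g₀ : Carrier
    g₀ = proj₁ (ax4 Θ f)
    open BooleanValue Θ (g₀ ∷ᵥ f) (ax2 Θ (g₀ ∷ᵥ f)) using (¬sat⇒≤¬)
    exceptions : Finite (bv (`∃ Θ) f ∧B (¬B bv Θ (g₀ ∷ᵥ f)))
    exceptions = proj₂ (ax4 Θ f) fin
    es : List Carrier
    es = proj₁ exceptions
    es-atoms : All Atom es
    es-atoms = proj₁ (proj₂ exceptions)
    es-join : joinL es ≈ (bv (`∃ Θ) f ∧B (¬B bv Θ (g₀ ∷ᵥ f)))
    es-join = proj₂ (proj₂ exceptions)
    witnesses : All Witnessed es
    witnesses = All.zipWith
      (λ (ae , e≤es) → ∃-≤⇒sat ae (≤-trans (≤-respʳ es-join e≤es) (∧-≤ˡ (proj₁ (ax2 (`∃ Θ) f)))))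
      (es-atoms , joinL-upper (All.map atom-idem es-atoms))
    good : ∀ {a} → Atom a → Sat (locStructure a) (`∃ Θ) f → Sat (locStructure a) Θ (spliceAll witnesses g₀ ∷ᵥ f)
    good {a} at s with em {Sat (locStructure a) Θ (g₀ ∷ᵥ f)}
    ... | yes q  = spliceAll-good es-atoms witnesses at (inj₁ q)
    ... | no ¬q  = spliceAll-good es-atoms witnesses at (inj₂
      (atom≤joinL at es-atoms (≤-respʳ (sym es-join) (≤-∧ (∃-sat⇒≤ at s) (¬sat⇒≤¬ at ¬q)))))

module Combination {c ℓ} (R : CommutativeRing c ℓ) (em : ExcludedMiddle (c ⊔ ℓ))
    (φ : Formula 1) (bv : ∀ {n} → Formula n → Vector (CommutativeRing.Carrier R) n → CommutativeRing.Carrier R)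
    (ax2 : RingDefs.Axiom2 R bv)
    {k : ℕ} (Y : Fin k → CommutativeRing.Carrier R) (Y-partition : RingDefs.IsBPartition R Y)
    {m : ℕ} (Θ : Fin k → Formula (nsuc m)) (f : Vector (CommutativeRing.Carrier R) m) where
  open CommutativeRing R hiding (zero)
  open RingDefs R
  open IdempotentOrder R
  open Atomic R em
  open SetoidReasoning setoid

  P : Vector Carrier (m +ℕ k)
  P = f ++ᵥ Y

  -- Ψ(w, f, Y) = ⋁_j (Y_j = 1 ∧ Θ_j(f, w))
  Ψ : Formula (nsuc (m +ℕ k))
  Ψ = ⋁ λ j → (var (suc (m ↑ʳ j)) `≈ `1) `∧ renF (liftRen (_↑ˡ k)) (Θ j)

  module Loc (a : Carrier) = Satisfaction (locStructure a)

  restrict-to-f : ∀ a w → Loc._≋_ a (λ i → (w ∷ᵥ P) (liftRen (_↑ˡ k) i)) (w ∷ᵥ f)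
  restrict-to-f a w zero    = refl
  restrict-to-f a w (suc i) = *-congˡ (reflexive (P.cong [ f , Y ]′ (splitAt-↑ˡ m i k)))

  P-Y : ∀ j → P (m ↑ʳ j) ≈ Y j
  P-Y j = reflexive (P.cong [ f , Y ]′ (splitAt-↑ʳ m k j))

  Ψ⇒Θ : ∀ {a j w} → Atom a → a ≤B Y j → Sat (locStructure a) Ψ (w ∷ᵥ P) → Sat (locStructure a) (Θ j) (w ∷ᵥ f)
  Ψ⇒Θ {a} {j} {w} at a≤Yj s with Loc.sat-⋁⁻ a _ s
  ... | i , lift Yi≈1 , sΘ with i ≟ j
  ...   | yes P.refl = Loc.sat-ren→ a (Θ j) (restrict-to-f a w) sΘ
  ...   | no i≢j     = ⊥-elim (atom≢0 at (begin
          a                ≈⟨ sym a≤Yj ⟩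
          a * Y j          ≈⟨ *-congʳ (sym a≤Yi) ⟩
          (a * Y i) * Y j  ≈⟨ *-assoc a (Y i) (Y j) ⟩
          a * (Y i * Y j)  ≈⟨ *-congˡ (proj₂ (proj₂ Y-partition) i j i≢j) ⟩
          a * 0#           ≈⟨ zeroʳ a ⟩
          0#               ∎))
      where
      a≤Yi : a ≤B Y i
      a≤Yi = trans (*-congˡ (sym (P-Y i))) (trans Yi≈1 (*-identityʳ a))

  Θ⇒Ψ : ∀ {a j w} → a ≤B Y j → Sat (locStructure a) (Θ j) (w ∷ᵥ f) → Sat (locStructure a) Ψ (w ∷ᵥ P)
  Θ⇒Ψ {a} {j} {w} a≤Yj s = Loc.sat-⋁⁺ a _ j
    ( lift (trans (*-congˡ (P-Y j)) (trans a≤Yj (sym (*-identityʳ a))))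
    , Loc.sat-ren← a (Θ j) (restrict-to-f a w) s )

  ∃Θ⇒∃Ψ : ∀ {a j} → a ≤B Y j → Sat (locStructure a) (`∃ (Θ j)) f → Sat (locStructure a) (`∃ Ψ) P
  ∃Θ⇒∃Ψ a≤Yj (w , s) = w , Θ⇒Ψ a≤Yj s

  φ-transfer : ∀ {a w} → Sat (locStructure a) (atW φ) (w ∷ᵥ f) → Sat (locStructure a) (atW φ) (w ∷ᵥ P)
  φ-transfer {a} s = Loc.sat-ren← a φ (λ _ → refl) (Loc.sat-ren→ a φ (λ _ → refl) s)

  -- Every atom of [[∃Ψ]] ∧ ¬[[∃(φ ∧ Ψ)]] lies in some Y_j ∧ ¬[[∃(φ ∧ Θ_j)]].
  Ψ-exceptions-finite : Axiom1 → (∀ j → Finite (Y j ∧B (¬B bv (`∃ (atW φ `∧ Θ j)) f))) →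
                        Finite (bv (`∃ Ψ) P ∧B (¬B bv (`∃ (atW φ `∧ Ψ)) P))
  Ψ-exceptions-finite atomic Y-finite =
    finite-if-covered atomic (∧-idem (proj₁ (ax2 (`∃ Ψ) P)) (¬-idem (proj₁ (ax2 (`∃ (atW φ `∧ Ψ)) P)))) all-atoms covered
    where
    open BooleanValue (`∃ (atW φ `∧ Ψ)) P (ax2 (`∃ (atW φ `∧ Ψ)) P) using (≤¬⇒¬sat)
    atomsOf : Fin k → List Carrier
    atomsOf j = proj₁ (Y-finite j)
    all-atoms : All Atom (concat (tabulate atomsOf))
    all-atoms = All.concat⁺ (All.tabulate⁺ (λ j → proj₁ (proj₂ (Y-finite j))))
    covered : ∀ {a} → Atom a → a ≤B (bv (`∃ Ψ) P ∧B (¬B bv (`∃ (atW φ `∧ Ψ)) P)) →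
              Any (a ≈_) (concat (tabulate atomsOf))
    covered {a} at a≤X = Any.concat⁺ (Any.tabulate⁺ j (atom≤joinL at (proj₁ (proj₂ (Y-finite j)))
      (≤-respʳ (sym (proj₂ (proj₂ (Y-finite j)))) (≤-∧ a≤Yj a≤¬φΘj))))
      where
      a-in-Y : Σ (Fin k) (λ j → a ≤B Y j)
      a-in-Y = atom≤bigJoin (proj₁ Y-partition) at
        (≤-respʳ (sym (proj₁ (proj₂ Y-partition))) (*-identityʳ a))
      j : Fin k
      j = proj₁ a-in-Y
      a≤Yj : a ≤B Y j
      a≤Yj = proj₂ a-in-Y
      ¬φΨ : ¬ Sat (locStructure a) (`∃ (atW φ `∧ Ψ)) P
      ¬φΨ = ≤¬⇒¬sat at (≤-trans a≤X (∧-≤ʳ (¬-idem (proj₁ (ax2 (`∃ (atW φ `∧ Ψ)) P)))))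
      a≤¬φΘj : a ≤B (¬B bv (`∃ (atW φ `∧ Θ j)) f)
      a≤¬φΘj = BooleanValue.¬sat⇒≤¬ (`∃ (atW φ `∧ Θ j)) f (ax2 (`∃ (atW φ `∧ Θ j)) f) at
        λ (w , sφ , sΘ) → ¬φΨ (w , φ-transfer sφ , Θ⇒Ψ a≤Yj sΘ)

mainTheorem1 : ∀ {c ℓ} (R : CommutativeRing c ℓ) → ExcludedMiddle (c ⊔ ℓ)
    → let open CommutativeRing R
          open RingDefs R
      in ¬ (0# ≈ 1#)
    → (φ : Formula 1)
    → (bv : ∀ {n} → Formula n → Vector Carrier n → Carrier)
    → Axiom1 → Axiom2 bv → Axiom3 bv → Axiom4⁺ φ bv
    → (k : ℕ) (Y : Fin k → Carrier) → IsBPartition Y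
    → (m : ℕ) (Θ : Fin k → Formula (nsuc m)) → IsFormulaPartition c ℓ Θ
    → (f : Vector Carrier m)
    → (∀ j → Y j ≤B bv (`∃ (Θ j)) f)
    → (∀ j → Finite (Y j ∧B (¬B bv (`∃ (atW φ `∧ Θ j)) f)))
    → Σ Carrier (λ g → ∀ j → Y j ≤B bv (Θ j) (g ∷ᵥ f))
mainTheorem1 R em _ φ bv atomic ax2 _ ax4 k Y Y-partition m Θ _ f Y≤∃Θ Y-finite = g , Y≤Θg
  where
  open CommutativeRing R hiding (zero)
  open RingDefs R
  open IdempotentOrder R
  open Atomic R em
  open Combination R em φ bv ax2 Y Y-partition Θ f
  uniform : Σ Carrier λ g → ∀ {a} → Atom a → Sat (locStructure a) (`∃ Ψ) P → Sat (locStructure a) Ψ (g ∷ᵥ P)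
  uniform = UniformWitness.uniform-witness R em φ bv ax2 ax4 Ψ P (Ψ-exceptions-finite atomic Y-finite)
  g : Carrier
  g = proj₁ uniform
  -- at an atom a ≤ Y_j: ∃Θ_j holds, so ∃Ψ holds, so Ψ(g) holds, so Θ_j(g) holds
  Y≤Θg : ∀ j → Y j ≤B bv (Θ j) (g ∷ᵥ f)
  Y≤Θg j = ≤-by-atoms atomic (proj₁ Y-partition j) (proj₁ (ax2 (Θ j) (g ∷ᵥ f))) λ at a≤Yj →
    BooleanValue.sat⇒≤ (Θ j) (g ∷ᵥ f) (ax2 (Θ j) (g ∷ᵥ f)) at (Ψ⇒Θ at a≤Yj (proj₂ uniform at (∃Θ⇒∃Ψ a≤Yj
      (BooleanValue.≤⇒sat (`∃ (Θ j)) f (ax2 (`∃ (Θ j)) f) at (≤-trans a≤Yj (Y≤∃Θ j))))))
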